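{- Let $evs\in\mathit{nsl}$ and suppose $\mathit{Crypt}\ (\mathit{pubK}\ B)\ \langle\mathit{Nonce}\ NA,\mathit{Agent}\ A\rangle\in\mathit{parts}(\mathit{spies}\ evs)$ and $\mathit{Crypt}\ (\mathit{pubK}\ B')\ \langle\mathit{Nonce}\ NA',\mathit{Nonce}\ NA,\mathit{Agent}\ A'\rangle\in\mathit{parts}(\mathit{spies}\ evs)$. Then $\mathit{Nonce}\ NA\in\mathit{analz}(\mathit{spies}\ evs)$.
   Context: Messages: free datatype msg ::= Number nat | Nonce nat | Agent agent | Key key | Hash msg | ⟨msg,msg⟩ | Crypt key msg; ⟨X,Y,Z⟩ abbreviates ⟨X,⟨Y,Z⟩⟩. Each agent $A$ has a public key $\mathit{pubK}\ A$ and private key $\mathit{priK}\ A$, inverse to each other under $\mathit{invKey}$. $\mathit{parts}\ H$ closes $H$ under pair components and encryption bodies; $\mathit{analz}\ H$ closes $H$ under pair components and decryption of $\mathit{Crypt}\ K\ X$ when $\mathit{Key}(\mathit{invKey}\ K)$ is already in it; $\mathit{synth}\ H$ closes $H$ under adding agent names, numbers, hashing, pairing and encryption with keys $\mathit{Key}\ K\in H$. Events are $\mathit{Says}\ A\ B\ X$; $\mathit{set}\ evs$ is the set of events of trace $evs$; $\mathit{spies}\ evs$ is the spy's knowledge: its initial knowledge (all public keys, private keys of compromised agents) plus every message sent in $evs$; $\mathit{used}\ evs$ is the parts of all messages sent (and of initial knowledge). $\mathit{nsl}$ is the least set of traces with: $[]\in\mathit{nsl}$; (Fake) $evs\in\mathit{nsl}$,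 $X\in\mathit{synth}(\mathit{analz}(\mathit{spies}\ evs))\Rightarrow \mathit{Says}\ \mathit{Spy}\ B\ X\#evs\in\mathit{nsl}$; (NS1) $evs\in\mathit{nsl}$, $\mathit{Nonce}\ NA\notin\mathit{used}\ evs\Rightarrow \mathit{Says}\ A\ B\ (\mathit{Crypt}(\mathit{pubK}\ B)\langle\mathit{Nonce}\ NA,\mathit{Agent}\ A\rangle)\#evs\in\mathit{nsl}$; (NS2) $evs\in\mathit{nsl}$, $\mathit{Nonce}\ NB\notin\mathit{used}\ evs$, $\mathit{Says}\ A'\ B\ (\mathit{Crypt}(\mathit{pubK}\ B)\langle\mathit{Nonce}\ NA,\mathit{Agent}\ A\rangle)\in\mathit{set}\ evs\Rightarrow \mathit{Says}\ B\ A\ (\mathit{Crypt}(\mathit{pubK}\ A)\langle\mathit{Nonce}\ NA,\mathit{Nonce}\ NB,\mathit{Agent}\ B\rangle)\#evs\in\mathit{nsl}$; (NS3) $evs\in\mathit{nsl}$, $\mathit{Says}\ A\ B\ (\mathit{Crypt}(\mathit{pubK}\ B)\langle\mathit{Nonce}\ NA,\mathit{Agent}\ A\rangle)\in\mathit{set}\ evs$, $\mathit{Says}\ B'\ A\ (\mathit{Crypt}(\mathit{pubK}\ A)\langle\mathit{Nonce}\ NA,\mathit{Nonce}\ NB,\mathit{Agent}\ B\rangle)\in\mathit{set}\ evs\Rightarrow\mathit{Says}\ A\ B\ (\mathit{Crypt}(\mathit{pubK}\ B)(\mathit{Nonce}\ NB))\#evs\in\mathit{nsl}$. -}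

module Defs where

open import Data.Nat using (ℕ)
open import Data.Product using (∃; _×_; _,_)
open import Data.Sum using (_⊎_)
open import Data.List using (List; []; _∷_)
open import Data.List.Membership.Propositional using (_∈_)
open import Relation.Binary.PropositionalEquality using (_≡_)
open import Relation.Nullary using (¬_)

data Agent : Set where
  Server : Agent
  Friend : ℕ → Agent
  Spy    : Agent

data Key : Set where
  pubK : Agent → Key
  priK : Agent → Key

invKey : Key → Key
invKey (pubK A) = priK A
invKey (priK A) = pubK A

data Msg : Set where
  Number : ℕ → Msg
  Nonce  : ℕ → Msg
  Agent' : Agent → Msg
  Key'   : Key → Msg
  Hash   : Msg → Msg
  MPair  : Msg → Msg → Msg
  Crypt  : Key → Msg → Msg

-- ⟨X,Y⟩ is written MPair X Y; ⟨X,Y,Z⟩ = ⟨X,⟨Y,Z⟩⟩ is MPair X (MPair Y Z).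

MsgSet : Set₁
MsgSet = Msg → Set

data parts (H : MsgSet) : MsgSet where
  inj  : ∀ {X} → H X → parts H X
  fst  : ∀ {X Y} → parts H (MPair X Y) → parts H X
  snd  : ∀ {X Y} → parts H (MPair X Y) → parts H Y
  body : ∀ {K X} → parts H (Crypt K X) → parts H X

data analz (H : MsgSet) : MsgSet where
  inj     : ∀ {X} → H X → analz H X
  fst     : ∀ {X Y} → analz H (MPair X Y) → analz H X
  snd     : ∀ {X Y} → analz H (MPair X Y) → analz H Y
  decrypt : ∀ {K X} → analz H (Crypt K X) → analz H (Key' (invKey K)) → analz H X

data synth (H : MsgSet) : MsgSet where
  inj    : ∀ {X} → H X → synth H X
  agent  : ∀ A → synth H (Agent' A)
  number : ∀ n → synth H (Number n)
  hash   : ∀ {X} → synth H X → synth H (Hash X)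
  mpair  : ∀ {X Y} → synth H X → synth H Y → synth H (MPair X Y)
  crypt  : ∀ {K X} → synth H X → H (Key' K) → synth H (Crypt K X)

data Event : Set where
  Says : Agent → Agent → Msg → Event

Trace : Set
Trace = List Event

sentIn : Trace → MsgSet
sentIn evs X = ∃ λ A → ∃ λ B → Says A B X ∈ evs

module Model (bad : Agent → Set) where

  data initSpy : MsgSet where
    pub : ∀ A → initSpy (Key' (pubK A))
    pri : ∀ A → bad A → initSpy (Key' (priK A))

  spies : Trace → MsgSet
  spies evs X = initSpy X ⊎ sentIn evs X

  -- Union of all agents' initial knowledge: every agent knows all public
  -- keys and its own private key, so together: all keys.
  initAll : MsgSet
  initAll X = ∃ λ K → X ≡ Key' K

  used : Trace → MsgSet
  used evs = parts (λ X → initAll X ⊎ sentIn evs X)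

  data nsl : Trace → Set where
    Nil  : nsl []
    Fake : ∀ {evs B X} → nsl evs → synth (analz (spies evs)) X →
           nsl (Says Spy B X ∷ evs)
    NS1  : ∀ {evs A B NA} → nsl evs → ¬ used evs (Nonce NA) →
           nsl (Says A B (Crypt (pubK B) (MPair (Nonce NA) (Agent' A))) ∷ evs)
    NS2  : ∀ {evs A' A B NA NB} → nsl evs → ¬ used evs (Nonce NB) →
           Says A' B (Crypt (pubK B) (MPair (Nonce NA) (Agent' A))) ∈ evs →
           nsl (Says B A (Crypt (pubK A) (MPair (Nonce NA) (MPair (Nonce NB) (Agent' B)))) ∷ evs)
    NS3  : ∀ {evs A B B' NA NB} → nsl evs →
           Says A B (Crypt (pubK B) (MPair (Nonce NA) (Agent' A))) ∈ evs →
           Says B' A (Crypt (pubK A) (MPair (Nonce NA) (MPair (Nonce NB) (Agent' B)))) ∈ evs →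
           nsl (Says A B (Crypt (pubK B) (Nonce NB)) ∷ evs)

{-# OPTIONS --safe #-}
module Submission where

-- A Fake message yields one of the two ciphertexts
-- only if the spy can synthesise it, and synthesising it requires NA in
-- analz. An honest step yields at most one of them, and only with NA as its
-- freshly chosen nonce; but the other ciphertext is then already in the
-- trace and contains NA, contradicting freshness.

open import Defs
open import Data.Nat using (ℕ)
open import Data.Unit using (⊤)
open import Data.Empty using (⊥; ⊥-elim)
open import Data.Product using (_×_; _,_)
open import Data.Sum using (_⊎_; inj₁; inj₂; [_,_]′; map; map₂)
open import Data.List using (_∷_; [])
open import Data.List.Relation.Unary.Any using (here; there)
open import Relation.Binary.PropositionalEquality using (_≡_; refl)

parts-mono : ∀ {H G : MsgSet} → (∀ {X} → H X → G X) → ∀ {X} → parts H X → parts G X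
parts-mono f (inj h)  = inj (f h)
parts-mono f (fst p)  = fst (parts-mono f p)
parts-mono f (snd p)  = snd (parts-mono f p)
parts-mono f (body p) = body (parts-mono f p)

analz-mono : ∀ {H G : MsgSet} → (∀ {X} → H X → G X) → ∀ {X} → analz H X → analz G X
analz-mono f (inj h)       = inj (f h)
analz-mono f (fst a)       = fst (analz-mono f a)
analz-mono f (snd a)       = snd (analz-mono f a)
analz-mono f (decrypt a k) = decrypt (analz-mono f a) (analz-mono f k)

analz⊆parts : ∀ {H X} → analz H X → parts H X
analz⊆parts (inj h)       = inj h
analz⊆parts (fst a)       = fst (analz⊆parts a)
analz⊆parts (snd a)       = snd (analz⊆parts a)
analz⊆parts (decrypt a _) = body (analz⊆parts a)

parts-insert : ∀ {H : MsgSet} {X Y} →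
  parts (λ Z → Z ≡ X ⊎ H Z) Y → parts (_≡ X) Y ⊎ parts H Y
parts-insert (inj (inj₁ refl)) = inj₁ (inj refl)
parts-insert (inj (inj₂ h))    = inj₂ (inj h)
parts-insert (fst p)  = map fst fst (parts-insert p)
parts-insert (snd p)  = map snd snd (parts-insert p)
parts-insert (body p) = map body body (parts-insert p)

synth-Nonce⁻ : ∀ {H N} → synth H (Nonce N) → H (Nonce N)
synth-Nonce⁻ (inj h) = h

synth-analz-fst : ∀ {H X Y} → synth (analz H) (MPair X Y) → synth (analz H) X
synth-analz-fst (inj a)     = inj (fst a)
synth-analz-fst (mpair s _) = s

synth-analz-snd : ∀ {H X Y} → synth (analz H) (MPair X Y) → synth (analz H) Y
synth-analz-snd (inj a)     = inj (snd a)
synth-analz-snd (mpair _ t) = t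

synth-analz-Crypt⁻ : ∀ {H K X} →
  synth (analz H) (Crypt K X) → parts H (Crypt K X) ⊎ synth (analz H) X
synth-analz-Crypt⁻ (inj a)     = inj₁ (analz⊆parts a)
synth-analz-Crypt⁻ (crypt s _) = inj₂ s

parts-synth-analz : ∀ {H X} → parts (synth (analz H)) X → synth (analz H) X ⊎ parts H X
parts-synth-analz (inj s) = inj₁ s
parts-synth-analz (fst p) = map synth-analz-fst fst (parts-synth-analz p)
parts-synth-analz (snd p) = map synth-analz-snd snd (parts-synth-analz p)
parts-synth-analz (body p) with parts-synth-analz p
... | inj₂ q = inj₂ (body q)
... | inj₁ s = [ (λ q → inj₂ (body q)) , inj₁ ]′ (synth-analz-Crypt⁻ s)

CryptFree : Msg → Set
CryptFree (MPair X Y) = CryptFree X × CryptFree Y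
CryptFree (Crypt _ _) = ⊥
CryptFree _           = ⊤

parts-singleton-Crypt : ∀ {K Y Z} → CryptFree Y →
  parts (_≡ Crypt K Y) Z → Z ≡ Crypt K Y ⊎ CryptFree Z
parts-singleton-Crypt c (inj refl) = inj₁ refl
parts-singleton-Crypt c (fst p) with parts-singleton-Crypt c p
... | inj₂ (cx , _) = inj₂ cx
parts-singleton-Crypt c (snd p) with parts-singleton-Crypt c p
... | inj₂ (_ , cy) = inj₂ cy
parts-singleton-Crypt c (body p) with parts-singleton-Crypt c p
... | inj₁ refl = inj₂ c

module _ (bad : Agent → Set) where
  open Model bad

  parts-spies-[] : ∀ {X} → parts (spies []) X → initSpy X
  parts-spies-[] (inj (inj₁ k)) = k
  parts-spies-[] (fst p) with parts-spies-[] p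
  ... | ()
  parts-spies-[] (snd p) with parts-spies-[] p
  ... | ()
  parts-spies-[] (body p) with parts-spies-[] p
  ... | ()

  spies-∷ : ∀ {A B X evs Y} → spies (Says A B X ∷ evs) Y → Y ≡ X ⊎ spies evs Y
  spies-∷ (inj₁ k)                   = inj₂ (inj₁ k)
  spies-∷ (inj₂ (_ , _ , here refl)) = inj₁ refl
  spies-∷ (inj₂ (A , B , there e))   = inj₂ (inj₂ (A , B , e))

  parts-spies-∷ : ∀ {A B X evs Y} →
    parts (spies (Says A B X ∷ evs)) Y → parts (_≡ X) Y ⊎ parts (spies evs) Y
  parts-spies-∷ p = parts-insert (parts-mono spies-∷ p)

  analz-spies-∷⁺ : ∀ {e evs X} → analz (spies evs) X → analz (spies (e ∷ evs)) X
  analz-spies-∷⁺ = analz-mono λ where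
    (inj₁ k)           → inj₁ k
    (inj₂ (A , B , e)) → inj₂ (A , B , there e)

  parts-spies⊆used : ∀ {evs X} → parts (spies evs) X → used evs X
  parts-spies⊆used = parts-mono λ where
    (inj₁ (pub A))   → inj₁ (_ , refl)
    (inj₁ (pri A _)) → inj₁ (_ , refl)
    (inj₂ e)         → inj₂ e

  parts-Says-Crypt : ∀ {A B K K' X Y evs} → CryptFree Y →
    parts (spies (Says A B (Crypt K' Y) ∷ evs)) (Crypt K X) →
    Crypt K X ≡ Crypt K' Y ⊎ parts (spies evs) (Crypt K X)
  parts-Says-Crypt c p with parts-spies-∷ p
  ... | inj₂ q = inj₂ q
  ... | inj₁ q = map₂ ⊥-elim (parts-singleton-Crypt c q)

  parts-Fake-Crypt : ∀ {A B K X Y evs} → synth (analz (spies evs)) X →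
    parts (spies (Says A B X ∷ evs)) (Crypt K Y) →
    parts (spies evs) (Crypt K Y) ⊎ synth (analz (spies evs)) Y
  parts-Fake-Crypt s p with parts-spies-∷ p
  ... | inj₂ q = inj₁ q
  ... | inj₁ q with parts-synth-analz (parts-mono (λ { refl → s }) q)
  ...   | inj₂ q′ = inj₁ q′
  ...   | inj₁ s′ = synth-analz-Crypt⁻ s′

  no-nonce-NS1-NS2 : ∀ {evs : Trace} {A A' B B' : Agent} {NA NA' : ℕ} →
    nsl evs →
    parts (spies evs) (Crypt (pubK B) (MPair (Nonce NA) (Agent' A))) →
    parts (spies evs) (Crypt (pubK B') (MPair (Nonce NA') (MPair (Nonce NA) (Agent' A')))) →
    analz (spies evs) (Nonce NA)
  no-nonce-NS1-NS2 Nil p₁ _ with parts-spies-[] p₁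
  ... | ()
  no-nonce-NS1-NS2 (Fake ns s) p₁ p₂ with parts-Fake-Crypt s p₁ | parts-Fake-Crypt s p₂
  ... | inj₂ m₁ | _      = analz-spies-∷⁺ (synth-Nonce⁻ (synth-analz-fst m₁))
  ... | _      | inj₂ m₂ = analz-spies-∷⁺ (synth-Nonce⁻ (synth-analz-fst (synth-analz-snd m₂)))
  ... | inj₁ q₁ | inj₁ q₂ = analz-spies-∷⁺ (no-nonce-NS1-NS2 ns q₁ q₂)
  no-nonce-NS1-NS2 (NS1 ns fresh) p₁ p₂ with parts-Says-Crypt _ p₁ | parts-Says-Crypt _ p₂
  ... | _         | inj₁ ()
  ... | inj₁ refl | inj₂ q₂ = ⊥-elim (fresh (parts-spies⊆used (fst (snd (body q₂)))))
  ... | inj₂ q₁   | inj₂ q₂ = analz-spies-∷⁺ (no-nonce-NS1-NS2 ns q₁ q₂)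
  no-nonce-NS1-NS2 (NS2 ns fresh _) p₁ p₂ with parts-Says-Crypt _ p₁ | parts-Says-Crypt _ p₂
  ... | inj₁ ()  | _
  ... | inj₂ q₁ | inj₁ refl = ⊥-elim (fresh (parts-spies⊆used (fst (body q₁))))
  ... | inj₂ q₁ | inj₂ q₂   = analz-spies-∷⁺ (no-nonce-NS1-NS2 ns q₁ q₂)
  no-nonce-NS1-NS2 (NS3 ns _ _) p₁ p₂ with parts-Says-Crypt _ p₁ | parts-Says-Crypt _ p₂
  ... | inj₁ ()  | _
  ... | _       | inj₁ ()
  ... | inj₂ q₁ | inj₂ q₂ = analz-spies-∷⁺ (no-nonce-NS1-NS2 ns q₁ q₂)

mainTheorem7 : (bad : Agent → Set) → bad Spy →
    ∀ {evs : Trace} {A A' B B' : Agent} {NA NA' : ℕ} →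
    Model.nsl bad evs →
    parts (Model.spies bad evs) (Crypt (pubK B) (MPair (Nonce NA) (Agent' A))) →
    parts (Model.spies bad evs) (Crypt (pubK B') (MPair (Nonce NA') (MPair (Nonce NA) (Agent' A')))) →
    analz (Model.spies bad evs) (Nonce NA)
mainTheorem7 bad _ = no-nonce-NS1-NS2 bad
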